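{- Let $q\in\mathbb{N}$ with $q\ge 3$. Let $r=s/t\in(0,1)\cap\mathbb{Q}$ with $s,t\in\mathbb{N}$, $\gcd(s,t)=1$. If $t$ has a prime factor that does not divide $q$, then for every positive rational $\alpha$ there exists $k_\alpha\in\mathbb{N}$ such that for every $k\ge k_\alpha$ the $q$-adic expansion of $\alpha r^k$ contains every digit in $\{0,1,\ldots,q-1\}$. -}

module Defs where

open import Data.Nat as ℕ using (ℕ; zero; suc; _≤_; _∸_; NonZero)
open import Data.Nat.Properties using (m^n≢0)
open import Data.Nat.DivMod using (_/_; _%_)
open import Data.Nat.Divisibility using (_∣_)
open import Data.Integer using (∣_∣)
open import Data.Rational using (ℚ; ↥_; ↧ₙ_; 1ℚ; _*_)
open import Data.Product using (Σ; _×_)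
open import Data.Sum using (_⊎_)
open import Relation.Nullary using (¬_)
open import Relation.Binary.PropositionalEquality using (_≡_)

_^ℚ_ : ℚ → ℕ → ℚ
x ^ℚ zero    = 1ℚ
x ^ℚ (suc k) = x * (x ^ℚ k)

-- For x = a / b (a = |numerator|, b = denominator), the q-adic digits:
-- integer-part digit at position i ≥ 0 : ⌊x / q^i⌋ mod q = (⌊a/b⌋ / q^i) mod q
intDigit : (q : ℕ) → .{{NonZero q}} → ℚ → ℕ → ℕ
intDigit q x i = ((∣ ↥ x ∣ / ↧ₙ x) / (q ℕ.^ i)) {{m^n≢0 q i}} % q

-- fractional digit at position j ≥ 1 : ⌊x q^j⌋ mod q
fracDigit : (q : ℕ) → .{{NonZero q}} → ℚ → ℕ → ℕ
fracDigit q x j = ((∣ ↥ x ∣ ℕ.* q ℕ.^ j) / ↧ₙ x) % q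

-- The q-adic expansion of a nonnegative rational x contains the digit d:
--  * either d occurs among the digits of the integer part ⌊x⌋ (no leading zeros:
--    only positions i with q^i ≤ ⌊x⌋), or
--  * d occurs at a fractional position j ≥ 1 which is genuinely part of the
--    (finite or infinite) expansion, i.e. the tail from position j on is not
--    identically zero: x q^(j-1) is not an integer (no trailing zeros).
HasDigit : (q : ℕ) → .{{NonZero q}} → ℚ → ℕ → Set
HasDigit q x d =
  (Σ ℕ λ i → (q ℕ.^ i ≤ ∣ ↥ x ∣ / ↧ₙ x) × intDigit q x i ≡ d)
  ⊎ (Σ ℕ λ j → (1 ≤ j) × (¬ (↧ₙ x ∣ ∣ ↥ x ∣ ℕ.* q ℕ.^ (j ∸ 1))) × fracDigit q x j ≡ d)

{-# OPTIONS --safe #-}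
module Submission where

-- Write α rᵏ = A / B with A = a sᵏ, B = b tᵏ (α = a / b), and fix a prime p ∣ t with p ∤ q,
-- so p ∤ s. The p-adic valuation of B grows linearly in k while that of A qʲ stays v_p(a),
-- so the expansion never terminates. By pigeonhole, q^N₀ (q^n₀ − 1) is divisible by p² and by
-- the p-free part Z of b t; raising q^n₀ to the power Zᵏ pⁱ (lifting the exponent) gives N, n
-- with A q^N (qⁿ − 1) = c D, where B = D p^(2q) and p ∤ c. Hence A q^(N + n i) ≡ A q^N + i c D
-- (mod B), and as c is invertible mod p^(2q), these remainders run through all A q^N mod D + m D.
-- They are B / p^(2q) < B / (2q) apart, so one of them lies in [d B / q, (d + 1) B / q): the next
-- q-adic digit of A q^(N + n i) / B is then d.

open import Defs

module PrimePowers where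
  open import Data.Nat
  open import Data.Nat.Properties
  open import Data.Nat.Divisibility
  open import Data.Nat.DivMod
  open import Data.Nat.Primality
  open import Data.Nat.Coprimality using (Coprime; coprime-divisor)
  import Data.Nat.Coprimality as Coprime
  open import Algebra.Properties.CommutativeSemigroup *-commutativeSemigroup using (x∙yz≈y∙xz; xy∙z≈xz∙y; interchange)
  open import Data.Nat.Induction using (<-wellFounded)
  open import Induction.WellFounded using (Acc; acc)
  open import Data.Nat.Tactic.RingSolver using (solve-∀; solve)
  open import Data.List using (_∷_; [])
  open import Data.Fin using (toℕ; fromℕ<)
  open import Data.Fin.Properties using (pigeonhole; toℕ-fromℕ<)
  open import Data.Product using (∃; ∃-syntax; _,_; _×_)
  open import Data.Sum using (inj₁; inj₂)
  open import Relation.Nullary using (¬_; yes; no; contradiction)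
  open import Relation.Binary.PropositionalEquality

  ^-monoʳ-∣ : ∀ p {m n} → m ≤ n → p ^ m ∣ p ^ n
  ^-monoʳ-∣ p {m} {n} m≤n = divides (p ^ (n ∸ m)) (begin
    p ^ n             ≡⟨ cong (p ^_) (sym (m∸n+n≡m m≤n)) ⟩
    p ^ (n ∸ m + m)   ≡⟨ ^-distribˡ-+-* p (n ∸ m) m ⟩
    p ^ (n ∸ m) * p ^ m ∎)
    where open ≡-Reasoning

  ^-distribʳ-* : ∀ m n k → (m * n) ^ k ≡ m ^ k * n ^ k
  ^-distribʳ-* m n zero    = refl
  ^-distribʳ-* m n (suc k) = trans (cong (m * n *_) (^-distribʳ-* m n k)) (interchange m n (m ^ k) (n ^ k))

  ^-*-trans : ∀ b x y {c d} → b ^ x ≡ c → c ^ y ≡ d → b ^ (y * x) ≡ d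
  ^-*-trans b x y refl refl = trans (cong (b ^_) (*-comm y x)) (sym (^-*-assoc b x y))

  ^-split : ∀ b x y c → y ≤ x → b ^ x * c ≡ b ^ (x ∸ y) * c * b ^ y
  ^-split b x y c y≤x = begin
    b ^ x * c                 ≡⟨ cong (λ z → b ^ z * c) (m∸n+n≡m y≤x) ⟨
    b ^ (x ∸ y + y) * c       ≡⟨ cong (_* c) (^-distribˡ-+-* b (x ∸ y) y) ⟩
    b ^ (x ∸ y) * b ^ y * c   ≡⟨ xy∙z≈xz∙y (b ^ (x ∸ y)) (b ^ y) c ⟩
    b ^ (x ∸ y) * c * b ^ y   ∎
    where open ≡-Reasoning

  n<m^n : ∀ {m} n → 1 < m → n < m ^ n
  n<m^n zero    1<m = s≤s z≤n
  n<m^n {m} (suc n) 1<m = ≤-<-trans (n<m^n n 1<m) (subst (m ^ n <_) (*-comm (m ^ n) m) m^n<m^n*m)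
    where
    m^n<m^n*m : m ^ n < m ^ n * m
    m^n<m^n*m = m<m*n (m ^ n) m {{m^n≢0 m n {{>-nonZero (<-trans z<s 1<m)}}}} 1<m

  binomial-tail : ∀ W m → ∃ λ T → (1 + W) ^ m ≡ 1 + W * (m + W * T)
  binomial-tail W zero    = 0 , solve (W ∷ [])
  binomial-tail W (suc m) with binomial-tail W m
  ... | T , eq = T + m + W * T , (begin
    (1 + W) * (1 + W) ^ m           ≡⟨ cong ((1 + W) *_) eq ⟩
    (1 + W) * (1 + W * (m + W * T)) ≡⟨ solve (W ∷ m ∷ T ∷ []) ⟩
    1 + W * (suc m + W * (T + m + W * T)) ∎)
    where open ≡-Reasoning

  [m+n]%o≡m%o⇒o∣n : ∀ m n o .{{_ : NonZero o}} → (m + n) % o ≡ m % o → o ∣ n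
  [m+n]%o≡m%o⇒o∣n m n o eq = divides ((m + n) / o ∸ m / o) (begin
    n                                                   ≡⟨ m+n∸m≡n m n ⟨
    m + n ∸ m                                           ≡⟨ cong₂ _∸_ (m≡m%n+[m/n]*n (m + n) o) (m≡m%n+[m/n]*n m o) ⟩
    (m + n) % o + (m + n) / o * o ∸ (m % o + m / o * o) ≡⟨ cong (λ r → r + (m + n) / o * o ∸ (m % o + m / o * o)) eq ⟩
    m % o + (m + n) / o * o ∸ (m % o + m / o * o)       ≡⟨ [m+n]∸[m+o]≡n∸o (m % o) _ _ ⟩
    (m + n) / o * o ∸ m / o * o                         ≡⟨ *-distribʳ-∸ o ((m + n) / o) (m / o) ⟨
    ((m + n) / o ∸ m / o) * o                           ∎)
    where open ≡-Reasoning

  powers-periodic-mod : ∀ {q} M .{{_ : NonZero M}} → 1 < q →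
    ∃[ N ] ∃[ n ] ∃[ W ] q ^ n ≡ 1 + W × NonZero W × M ∣ q ^ N * W
  powers-periodic-mod {q} M 1<q with pigeonhole (n<1+n M) (λ i → fromℕ< (m%n<n (q ^ toℕ i) M))
  ... | i , j , i<j , same-residue = toℕ i , n , W , q^n≡1+W , >-nonZero 0<W , M∣q^iW
    where
    instance q≢0 = >-nonZero (<-trans z<s 1<q)
    n = toℕ j ∸ toℕ i
    1<q^n : 1 < q ^ n
    1<q^n = ^-monoʳ-< q 1<q (m<n⇒0<n∸m i<j)
    W = q ^ n ∸ 1
    q^n≡1+W : q ^ n ≡ 1 + W
    q^n≡1+W = sym (m+[n∸m]≡n (<⇒≤ 1<q^n))
    0<W : 0 < W
    0<W = m<n⇒0<n∸m 1<q^n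
    q^j≡q^i+q^iW : q ^ toℕ j ≡ q ^ toℕ i + q ^ toℕ i * W
    q^j≡q^i+q^iW = begin
      q ^ toℕ j                     ≡⟨ cong (q ^_) (m+[n∸m]≡n (<⇒≤ i<j)) ⟨
      q ^ (toℕ i + n)               ≡⟨ ^-distribˡ-+-* q (toℕ i) n ⟩
      q ^ toℕ i * q ^ n             ≡⟨ cong (q ^ toℕ i *_) q^n≡1+W ⟩
      q ^ toℕ i * (1 + W)           ≡⟨ *-distribˡ-+ (q ^ toℕ i) 1 W ⟩
      q ^ toℕ i * 1 + q ^ toℕ i * W ≡⟨ cong (_+ q ^ toℕ i * W) (*-identityʳ (q ^ toℕ i)) ⟩
      q ^ toℕ i + q ^ toℕ i * W     ∎
      where open ≡-Reasoning
    M∣q^iW : M ∣ q ^ toℕ i * W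
    M∣q^iW = [m+n]%o≡m%o⇒o∣n (q ^ toℕ i) _ M (begin
      (q ^ toℕ i + q ^ toℕ i * W) % M    ≡⟨ cong (_% M) q^j≡q^i+q^iW ⟨
      q ^ toℕ j % M                      ≡⟨ toℕ-fromℕ< (m%n<n (q ^ toℕ j) M) ⟨
      toℕ (fromℕ< (m%n<n (q ^ toℕ j) M)) ≡⟨ cong toℕ same-residue ⟨
      toℕ (fromℕ< (m%n<n (q ^ toℕ i) M)) ≡⟨ toℕ-fromℕ< (m%n<n (q ^ toℕ i) M) ⟩
      q ^ toℕ i % M                      ∎)
      where open ≡-Reasoning

  infix 4 _^_∥_

  record _^_∥_ (p e m : ℕ) : Set where
    constructor split
    field
      cofactor : ℕ
      m≡p^e*cofactor : m ≡ p ^ e * cofactor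
      p∤cofactor : ¬ p ∣ cofactor

  open _^_∥_ public

  record NearOne (p q Z k E : ℕ) : Set where
    constructor near-one
    field
      N n W : ℕ
      q^n≡1+W : q ^ n ≡ 1 + W
      W∥ : p ^ E ∥ W
      Z^k+1∣q^N*w : Z ^ suc k ∣ q ^ N * cofactor W∥

  module _ {p : ℕ} (prime-p : Prime p) where

    private
      instance
        p≢0 : NonZero p
        p≢0 = prime⇒nonZero prime-p

      p≢1 : p ≢ 1
      p≢1 refl = contradiction prime-p ¬prime[1]

    ∤-* : ∀ {m n} → ¬ p ∣ m → ¬ p ∣ n → ¬ p ∣ m * n
    ∤-* p∤m p∤n p∣mn with euclidsLemma _ _ prime-p p∣mn
    ... | inj₁ p∣m = p∤m p∣m
    ... | inj₂ p∣n = p∤n p∣n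

    ∤-^ : ∀ {m} k → ¬ p ∣ m → ¬ p ∣ m ^ k
    ∤-^ zero    p∤m p∣1 = p≢1 (∣1⇒≡1 p∣1)
    ∤-^ (suc k) p∤m     = ∤-* p∤m (∤-^ k p∤m)

    ∣⇒∤1+ : ∀ {m} → p ∣ m → ¬ p ∣ 1 + m
    ∣⇒∤1+ p∣m p∣1+m = p≢1 (∣1⇒≡1 (∣m+n∣m⇒∣n (subst (p ∣_) (+-comm 1 _) p∣1+m) p∣m))

    coprime∧∣⇒∤ : ∀ {m n} → Coprime m n → p ∣ n → ¬ p ∣ m
    coprime∧∣⇒∤ m⊥n p∣n p∣m = p≢1 (m⊥n (p∣m , p∣n))

    ∤⇒nonZero : ∀ {m} → ¬ p ∣ m → NonZero m
    ∤⇒nonZero {zero}  p∤0 = contradiction (p ∣0) p∤0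
    ∤⇒nonZero {suc m} _   = _

    ∤⇒coprime : ∀ {m} → ¬ p ∣ m → Coprime p m
    ∤⇒coprime p∤m (d∣p , d∣m) with prime⇒irreducible prime-p d∣p
    ... | inj₁ d≡1    = d≡1
    ... | inj₂ refl   = contradiction d∣m p∤m

    ∤⇒coprime-^ : ∀ {m} e → ¬ p ∣ m → Coprime (p ^ e) m
    ∤⇒coprime-^ zero    p∤m = Coprime.1-coprimeTo _
    ∤⇒coprime-^ (suc e) p∤m = coprime-* (∤⇒coprime p∤m) (∤⇒coprime-^ e p∤m)
      where
      coprime-* : ∀ {a b m} → Coprime a m → Coprime b m → Coprime (a * b) m
      coprime-* a⊥m b⊥m (d∣ab , d∣m) =
        b⊥m (coprime-divisor (λ (x∣d , x∣a) → a⊥m (x∣a , ∣-trans x∣d d∣m)) d∣ab , d∣m)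

    ∥⇒¬^suc∣ : ∀ {e m} → p ^ e ∥ m → ¬ p ^ suc e ∣ m
    ∥⇒¬^suc∣ {e} (split w refl p∤w) p^1+e∣m =
      p∤w (*-cancelˡ-∣ (p ^ e) {{m^n≢0 p e}} (subst (_∣ p ^ e * w) (*-comm p (p ^ e)) p^1+e∣m))

    ∥∧^∣⇒≤ : ∀ {e f m} → p ^ e ∥ m → p ^ f ∣ m → f ≤ e
    ∥∧^∣⇒≤ {e} {f} p^e∥m p^f∣m with f ≤? e
    ... | yes f≤e = f≤e
    ... | no  f≰e = contradiction (∣-trans (^-monoʳ-∣ p (≰⇒> f≰e)) p^f∣m) (∥⇒¬^suc∣ p^e∥m)

    ∥∧∥⇒∤ : ∀ {x y m n} → p ^ x ∥ m → p ^ y ∥ n → x < y → ¬ n ∣ m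
    ∥∧∥⇒∤ m∥ (split d refl _) x<y n∣m = <⇒≱ x<y (∥∧^∣⇒≤ m∥ (∣-trans (m∣m*n d) n∣m))

    ∥⇒nonZero : ∀ {e m} → p ^ e ∥ m → NonZero m
    ∥⇒nonZero {e} (split c refl p∤c) = m*n≢0 (p ^ e) c {{m^n≢0 p e}} {{∤⇒nonZero p∤c}}

    ∥-*-∤ : ∀ {e m x} → p ^ e ∥ m → ¬ p ∣ x → p ^ e ∥ m * x
    ∥-*-∤ {e} {x = x} (split w m≡ p∤w) p∤x =
      split (w * x) (trans (cong (_* x) m≡) (*-assoc (p ^ e) w x)) (∤-* p∤w p∤x)

    ∥-* : ∀ {x y m n} → p ^ x ∥ m → p ^ y ∥ n → p ^ (x + y) ∥ m * n
    ∥-* {x} {y} {m} {n} (split c m≡ p∤c) (split d n≡ p∤d) = split (c * d) m*n≡ (∤-* p∤c p∤d)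
      where
      open ≡-Reasoning
      m*n≡ : m * n ≡ p ^ (x + y) * (c * d)
      m*n≡ = begin
        m * n                       ≡⟨ cong₂ _*_ m≡ n≡ ⟩
        p ^ x * c * (p ^ y * d)     ≡⟨ interchange (p ^ x) c (p ^ y) d ⟩
        p ^ x * p ^ y * (c * d)     ≡⟨ cong (_* (c * d)) (^-distribˡ-+-* p x y) ⟨
        p ^ (x + y) * (c * d)       ∎

    ∥-^ : ∀ {x m} → p ^ x ∥ m → ∀ k → p ^ (k * x) ∥ m ^ k
    ∥-^ {x} {m} (split c m≡ p∤c) k = split (c ^ k) m^k≡ (∤-^ k p∤c)
      where
      open ≡-Reasoning
      m^k≡ : m ^ k ≡ p ^ (k * x) * c ^ k
      m^k≡ = begin
        m ^ k                   ≡⟨ cong (_^ k) m≡ ⟩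
        (p ^ x * c) ^ k         ≡⟨ ^-distribʳ-* (p ^ x) c k ⟩
        (p ^ x) ^ k * c ^ k     ≡⟨ cong (_* c ^ k) (^-*-assoc p x k) ⟩
        p ^ (x * k) * c ^ k     ≡⟨ cong (λ z → p ^ z * c ^ k) (*-comm x k) ⟩
        p ^ (k * x) * c ^ k     ∎

    valuation : ∀ m → .{{NonZero m}} → ∃ λ e → p ^ e ∥ m
    valuation m = go m (<-wellFounded m)
      where
      go : ∀ m → .{{NonZero m}} → Acc _<_ m → ∃ λ e → p ^ e ∥ m
      go m (acc rec) with p ∣? m
      ... | no  p∤m = 0 , split m (sym (+-identityʳ m)) p∤m
      ... | yes (divides m′ refl) with go m′ {{m′≢0}} (rec (m<m*n m′ p {{m′≢0}} (nonTrivial⇒n>1 p)))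
        where m′≢0 = m*n≢0⇒m≢0 m′
      ... | e , split w refl p∤w = suc e , split w (rotate (p ^ e) w p) p∤w
        where
        rotate : ∀ x y z → x * y * z ≡ z * x * y
        rotate = solve-∀

    lift-∤-step : ∀ {W Z c} → p ∣ W → ¬ p ∣ Z → Z ∣ c * W →
      ∃ λ X → (1 + W) ^ Z ≡ 1 + W * X × ¬ p ∣ X × Z ∣ c * X
    lift-∤-step {W} {Z} {c} p∣W p∤Z Z∣cW with binomial-tail W Z
    ... | T , eq = Z + W * T , eq , p∤Z+WT , Z∣cX
      where
      p∤Z+WT : ¬ p ∣ Z + W * T
      p∤Z+WT p∣Z+WT = p∤Z (∣m+n∣m⇒∣n (subst (p ∣_) (+-comm Z (W * T)) p∣Z+WT) (∣m⇒∣m*n T p∣W))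
      Z∣cX : Z ∣ c * (Z + W * T)
      Z∣cX = subst (Z ∣_) (sym (*-distribˡ-+ c Z (W * T)))
        (∣m∣n⇒∣m+n (n∣m*n c) (subst (Z ∣_) (*-assoc c W T) (∣m⇒∣m*n T Z∣cW)))

    lift-∤ : ∀ {e W Z c} → p ∣ W → p ^ e ∥ W → ¬ p ∣ Z → Z ∣ c * W → ∀ a →
      ∃ λ W′ → (1 + W) ^ (Z ^ a) ≡ 1 + W′ × W ∣ W′ × (p ^ e ∥ W′) × Z ^ suc a ∣ c ^ suc a * W′
    lift-∤ {W = W} {Z} {c} _ W∥ p∤Z Z∣cW zero =
      W , *-identityʳ (1 + W) , ∣-refl , W∥ ,
      subst₂ _∣_ (sym (*-identityʳ Z)) (cong (_* W) (sym (*-identityʳ c))) Z∣cW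
    lift-∤ {e} {W} {Z} {c} p∣W W∥ p∤Z Z∣cW (suc a) with lift-∤ {c = c} p∣W W∥ p∤Z Z∣cW a
    ... | W′ , eq , W∣W′ , W′∥ , Z^a∣
      with lift-∤-step {c = c} (∣-trans p∣W W∣W′) p∤Z (∣-trans Z∣cW (*-monoʳ-∣ c W∣W′))
    ... | X , eqX , p∤X , Z∣cX =
      W′ * X , ^-*-trans (1 + W) (Z ^ a) Z eq eqX , ∣m⇒∣m*n X W∣W′ , ∥-*-∤ W′∥ p∤X , Z^a+1∣
      where
      Z^a+1∣ : Z ^ suc (suc a) ∣ c ^ suc (suc a) * (W′ * X)
      Z^a+1∣ = subst (Z ^ suc (suc a) ∣_) (shuffle c (c ^ suc a) W′ X) (*-pres-∣ Z∣cX Z^a∣)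
        where
        shuffle : ∀ c d W X → c * X * (d * W) ≡ c * d * (W * X)
        shuffle = solve-∀

    -- (1 + W)ᵖ = 1 + p W + W² T, and 2 ≤ e keeps W² T / (p W) a multiple of p even for p = 2.
    lift-p-step : ∀ {e W} → 2 ≤ e → p ^ e ∥ W →
      ∃ λ W′ → (1 + W) ^ p ≡ 1 + W′ × W ∣ W′ × (p ^ suc e ∥ W′)
    lift-p-step {suc (suc e)} {W} (s≤s (s≤s _)) (split w refl p∤w) with binomial-tail W p
    ... | T , eq = W * (p + W * T) , eq , m∣m*n _ ,
                   split (w * (1 + p ^ suc e * w * T)) (factor p (p ^ e) w T) (∤-* p∤w p∤1+pX)
      where
      factor : ∀ p E w T →
        p * (p * E) * w * (p + p * (p * E) * w * T) ≡ p * (p * (p * E)) * (w * (1 + p * E * w * T))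
      factor = solve-∀
      p∤1+pX : ¬ p ∣ 1 + p ^ suc e * w * T
      p∤1+pX = ∣⇒∤1+ (∣m⇒∣m*n T (∣m⇒∣m*n w (m∣m*n (p ^ e))))

    lift-p : ∀ {e W} → 2 ≤ e → p ^ e ∥ W → ∀ i →
      ∃ λ W′ → (1 + W) ^ (p ^ i) ≡ 1 + W′ × W ∣ W′ × (p ^ (i + e) ∥ W′)
    lift-p {W = W} _ W∥ zero = W , *-identityʳ (1 + W) , ∣-refl , W∥
    lift-p {e} {W} 2≤e W∥ (suc i) with lift-p 2≤e W∥ i
    ... | W′ , eq , W∣W′ , W′∥ with lift-p-step (≤-trans 2≤e (m≤n+m e i)) W′∥
    ... | W″ , eq′ , W′∣W″ , W″∥ = W″ , ^-*-trans (1 + W) (p ^ i) p eq eq′ , ∣-trans W∣W′ W′∣W″ , W″∥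

    -- The witnesses are n = pⁱ Zᵏ n₀ and N = N₀ (k + 1), where Z p² ∣ q^N₀ (q^n₀ − 1).
    near-one-powers : ∀ {q Z} → 1 < q → ¬ p ∣ q → ¬ p ∣ Z → .{{NonZero Z}} →
      ∃ λ e₀ → ∀ k {E} → e₀ ≤ E → NearOne p q Z k E
    near-one-powers {q} {Z} 1<q p∤q p∤Z {{Z≢0}}
      with powers-periodic-mod (Z * p ^ 2) {{m*n≢0 Z (p ^ 2) {{Z≢0}} {{m^n≢0 p 2}}}} 1<q
    ... | N₀ , n₀ , W₀ , q^n₀≡1+W₀ , W₀≢0 , Zp²∣q^N₀W₀ with valuation W₀ {{W₀≢0}}
    ... | e₀ , W₀∥ = e₀ , λ k e₀≤E → subst (NearOne p q Z k) (m∸n+n≡m e₀≤E) (lift k _)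
      where
      p²∣W₀ : p ^ 2 ∣ W₀
      p²∣W₀ = coprime-divisor (∤⇒coprime-^ 2 (∤-^ N₀ p∤q)) (∣-trans (n∣m*n Z) Zp²∣q^N₀W₀)
      lift : ∀ k i → NearOne p q Z k (i + e₀)
      lift k i with lift-∤ {c = q ^ N₀} (∣-trans (m∣m*n (p ^ 1)) p²∣W₀) W₀∥ p∤Z
                                        (∣-trans (m∣m*n (p ^ 2)) Zp²∣q^N₀W₀) k
      ... | W₁ , eq₁ , _ , W₁∥ , Z^k+1∣ with lift-p (∥∧^∣⇒≤ W₀∥ p²∣W₀) W₁∥ i
      ... | W₂ , eq₂ , W₁∣W₂ , W₂∥@(split w₂ refl _) =
        near-one (N₀ * suc k) (p ^ i * (Z ^ k * n₀)) W₂
        (^-*-trans q (Z ^ k * n₀) (p ^ i) (^-*-trans q n₀ (Z ^ k) q^n₀≡1+W₀ eq₁) eq₂) W₂∥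
        (coprime-divisor (Coprime.sym (∤⇒coprime-^ (i + e₀) (∤-^ (suc k) p∤Z))) Z^k+1∣p^Eq^Nw₂)
        where
        Z^k+1∣p^Eq^Nw₂ : Z ^ suc k ∣ p ^ (i + e₀) * (q ^ (N₀ * suc k) * w₂)
        Z^k+1∣p^Eq^Nw₂ = subst (Z ^ suc k ∣_)
          (trans (cong (_* W₂) (^-*-assoc q N₀ (suc k))) (x∙yz≈y∙xz (q ^ (N₀ * suc k)) (p ^ (i + e₀)) w₂))
          (∣-trans Z^k+1∣ (*-monoʳ-∣ ((q ^ N₀) ^ suc k) W₁∣W₂))

module Expansion where
  open import Data.Nat
  open import Data.Nat.Properties
  open import Data.Nat.Divisibility
  open import Data.Nat.DivMod
  open import Data.Nat.Primality using (Prime; prime⇒nonZero; prime⇒nonTrivial)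
  open import Data.Nat.Coprimality using (Coprime; coprime-Bézout)
  import Data.Nat.Coprimality as Coprime
  open import Data.Nat.GCD using (module Bézout)
  open import Algebra.Properties.CommutativeSemigroup *-commutativeSemigroup using (x∙yz≈y∙xz; xy∙z≈y∙xz)
  open import Data.Nat.Tactic.RingSolver using (solve-∀; solve)
  open import Data.List using (_∷_; [])
  open import Data.Product using (∃; ∃-syntax; _,_; _×_; proj₁; proj₂)
  open import Relation.Nullary using (¬_)
  open import Relation.Binary.PropositionalEquality
  open PrimePowers

  cross-multiply : ∀ B n c A d → n * B ≡ A * d → B * (n * c) ≡ d * (A * c)
  cross-multiply B n c A d nB≡Ad = begin
    B * (n * c)   ≡⟨ x∙yz≈y∙xz B n c ⟩
    n * (B * c)   ≡⟨ *-assoc n B c ⟨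
    n * B * c     ≡⟨ cong (_* c) nB≡Ad ⟩
    A * d * c     ≡⟨ xy∙z≈y∙xz A d c ⟩
    d * (A * c)   ∎
    where open ≡-Reasoning

  digit-of-remainder : ∀ {q B r d} K .{{_ : NonZero q}} .{{_ : NonZero B}} → d < q →
    d * B ≤ q * r → q * r < suc d * B → (q * (r + K * B) / B) % q ≡ d
  digit-of-remainder {q} {B} {r} {d} K d<q dB≤qr qr<[1+d]B = begin
    (q * (r + K * B) / B) % q           ≡⟨ cong (λ x → x / B % q) q[r+KB]≡s+[d+Kq]B ⟩
    ((s + (d + K * q) * B) / B) % q     ≡⟨ cong (_% q) (+-distrib-/-∣ʳ s (n∣m*n (d + K * q))) ⟩
    (s / B + (d + K * q) * B / B) % q   ≡⟨ cong₂ (λ x y → (x + y) % q) (m<n⇒m/n≡0 s<B) (m*n/n≡m (d + K * q) B) ⟩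
    (d + K * q) % q                     ≡⟨ [m+kn]%n≡m%n d K q ⟩
    d % q                               ≡⟨ m<n⇒m%n≡m d<q ⟩
    d                                   ∎
    where
    open ≡-Reasoning
    s = q * r ∸ d * B
    dB+s≡qr : d * B + s ≡ q * r
    dB+s≡qr = m+[n∸m]≡n dB≤qr
    s<B : s < B
    s<B = +-cancelˡ-< (d * B) s B (subst₂ _<_ (sym dB+s≡qr) (+-comm B (d * B)) qr<[1+d]B)
    q[r+KB]≡s+[d+Kq]B : q * (r + K * B) ≡ s + (d + K * q) * B
    q[r+KB]≡s+[d+Kq]B = begin
      q * (r + K * B)         ≡⟨ *-distribˡ-+ q r (K * B) ⟩
      q * r + q * (K * B)     ≡⟨ cong (_+ q * (K * B)) dB+s≡qr ⟨
      d * B + s + q * (K * B) ≡⟨ regroup d B s q K ⟩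
      s + (d + K * q) * B     ∎
      where
      regroup : ∀ d B s q K → d * B + s + q * (K * B) ≡ s + (d + K * q) * B
      regroup = solve-∀

  -- m = ⌊d P / q⌋ + 1; successive values of ρ + m D differ by D, at most 1 / (2 q) of D P.
  digit-window : ∀ {q P D ρ d} .{{_ : NonZero q}} → 2 * q ≤ P → ρ < D → d < q →
    ∃ λ m → d * (D * P) ≤ q * (ρ + m * D) × q * (ρ + m * D) < suc d * (D * P)
  digit-window {q} {P} {D} {ρ} {d} 2q≤P ρ<D d<q = m , lower , upper
    where
    open ≤-Reasoning
    t = d * P / q
    m = suc t
    tq≤dP : t * q ≤ d * P
    tq≤dP = m/n*n≤m (d * P) q
    dP<mq : d * P < m * q
    dP<mq = begin-strict
      d * P                 ≡⟨ m≡m%n+[m/n]*n (d * P) q ⟩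
      d * P % q + t * q     <⟨ +-monoˡ-< (t * q) (m%n<n (d * P) q) ⟩
      m * q                 ∎
    lower : d * (D * P) ≤ q * (ρ + m * D)
    lower = begin
      d * (D * P)     ≡⟨ solve (d ∷ D ∷ P ∷ []) ⟩
      d * P * D       ≤⟨ *-monoˡ-≤ D (<⇒≤ dP<mq) ⟩
      m * q * D       ≡⟨ *-assoc m q D ⟩
      m * (q * D)     ≡⟨ x∙yz≈y∙xz m q D ⟩
      q * (m * D)     ≤⟨ *-monoʳ-≤ q (m≤n+m (m * D) ρ) ⟩
      q * (ρ + m * D) ∎
    upper : q * (ρ + m * D) < suc d * (D * P)
    upper = begin-strict
      q * (ρ + m * D)          ≡⟨ *-distribˡ-+ q ρ (m * D) ⟩
      q * ρ + q * (m * D)      <⟨ +-monoˡ-< (q * (m * D)) (*-monoʳ-< q ρ<D) ⟩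
      q * D + q * (m * D)      ≡⟨ expand q t D ⟩
      (2 * q + t * q) * D      ≤⟨ *-monoˡ-≤ D (+-mono-≤ 2q≤P tq≤dP) ⟩
      (P + d * P) * D          ≡⟨ solve (P ∷ d ∷ D ∷ []) ⟩
      suc d * (D * P)          ∎
      where
      expand : ∀ q t D → q * D + q * (suc t * D) ≡ (2 * q + t * q) * D
      expand = solve-∀

  coprime⇒invertible : ∀ {c P} → 1 < P → Coprime c P → ∃[ u ] ∃[ y ] u * c ≡ 1 + y * P
  coprime⇒invertible {c} {suc (suc P)} (s≤s (s≤s _)) c⊥P with coprime-Bézout c⊥P
  ... | Bézout.+- x y eq      = x , y , sym eq
  ... | Bézout.-+ x zero ()
  ... | Bézout.-+ x (suc y) eq =
    x * (1 + P) , y * (1 + P) + P , +-cancelˡ-≡ (1 + P) _ _ (begin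
      1 + P + x * (1 + P) * c            ≡⟨ solve (P ∷ x ∷ c ∷ []) ⟩
      (1 + P) * (1 + x * c)              ≡⟨ cong ((1 + P) *_) eq ⟩
      (1 + P) * (suc y * (2 + P))        ≡⟨ solve (P ∷ y ∷ []) ⟩
      1 + P + (1 + (y * (1 + P) + P) * (2 + P)) ∎)
    where open ≡-Reasoning

  every-residue : ∀ {c P m₀} m → (∃[ u ] ∃[ y ] u * c ≡ 1 + y * P) → m₀ ≤ m + P →
    ∃[ i ] ∃[ z ] m₀ + i * c ≡ m + z * P
  every-residue {c} {P} {m₀} m (u , y , uc≡1+yP) m₀≤m+P = δ * u , 1 + δ * y , (begin
    m₀ + δ * u * c          ≡⟨ cong (m₀ +_) (trans (*-assoc δ u c) (cong (δ *_) uc≡1+yP)) ⟩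
    m₀ + δ * (1 + y * P)    ≡⟨ regroup m₀ δ y P ⟩
    (m₀ + δ) + δ * y * P    ≡⟨ cong (_+ δ * y * P) (m+[n∸m]≡n m₀≤m+P) ⟩
    m + P + δ * y * P       ≡⟨ +-assoc m P (δ * y * P) ⟩
    m + (1 + δ * y) * P     ∎)
    where
    open ≡-Reasoning
    δ = m + P ∸ m₀
    regroup : ∀ m₀ δ y P → m₀ + δ * (1 + y * P) ≡ (m₀ + δ) + δ * y * P
    regroup = solve-∀

  HasFractionalDigit : (q A B d : ℕ) .{{_ : NonZero q}} .{{_ : NonZero B}} → Set
  HasFractionalDigit q A B d = ∃ λ j → 1 ≤ j × ¬ B ∣ A * q ^ (j ∸ 1) × (A * q ^ j / B) % q ≡ d

  -- As A q^N · e P = c D, multiplying by qⁿ = 1 + e P adds c D modulo D P.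
  orbit : ∀ {q A D P N n e c} → q ^ n ≡ 1 + e * P → A * q ^ N * (e * P) ≡ c * D →
    ∀ i → ∃ λ y → A * q ^ (N + n * i) ≡ A * q ^ N + i * c * D + y * (D * P)
  orbit {q} {A} {D} {P} {N} {n} {e} {c} q^n≡1+eP GeP≡cD zero =
    0 , (begin
      A * q ^ (N + n * 0)   ≡⟨ cong (λ x → A * q ^ (N + x)) (*-zeroʳ n) ⟩
      A * q ^ (N + 0)       ≡⟨ cong (λ x → A * q ^ x) (+-identityʳ N) ⟩
      A * q ^ N             ≡⟨ +-identityʳ (A * q ^ N) ⟨
      A * q ^ N + 0         ≡⟨ +-identityʳ (A * q ^ N + 0) ⟨
      A * q ^ N + 0 * c * D + 0 * (D * P) ∎)
    where open ≡-Reasoning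
  orbit {q} {A} {D} {P} {N} {n} {e} {c} q^n≡1+eP GeP≡cD (suc i)
    with orbit {q} {A} {D} {P} {N} {n} {e} {c} q^n≡1+eP GeP≡cD i
  ... | y , eq = i * c * e + y * (1 + e * P) , (begin
    A * q ^ (N + n * suc i)                     ≡⟨ cong (λ x → A * q ^ x) N+n[1+i]≡N+ni+n ⟩
    A * q ^ (N + n * i + n)                     ≡⟨ cong (A *_) (^-distribˡ-+-* q (N + n * i) n) ⟩
    A * (q ^ (N + n * i) * q ^ n)               ≡⟨ *-assoc A _ _ ⟨
    A * q ^ (N + n * i) * q ^ n                 ≡⟨ cong₂ _*_ eq q^n≡1+eP ⟩
    (G + i * c * D + y * (D * P)) * (1 + e * P) ≡⟨ expand G i c D y e P ⟩
    G + G * (e * P) + (i * c * D + i * c * e * (D * P) + y * (D * P) * (1 + e * P))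
      ≡⟨ cong (λ x → G + x + (i * c * D + i * c * e * (D * P) + y * (D * P) * (1 + e * P))) GeP≡cD ⟩
    G + c * D + (i * c * D + i * c * e * (D * P) + y * (D * P) * (1 + e * P))
      ≡⟨ collect G i c D y e P ⟩
    G + suc i * c * D + (i * c * e + y * (1 + e * P)) * (D * P) ∎)
    where
    open ≡-Reasoning
    G = A * q ^ N
    N+n[1+i]≡N+ni+n : N + n * suc i ≡ N + n * i + n
    N+n[1+i]≡N+ni+n = trans (cong (N +_) (trans (*-suc n i) (+-comm n (n * i)))) (sym (+-assoc N (n * i) n))
    expand : ∀ G i c D y e P → (G + i * c * D + y * (D * P)) * (1 + e * P)
      ≡ G + G * (e * P) + (i * c * D + i * c * e * (D * P) + y * (D * P) * (1 + e * P))
    expand = solve-∀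
    collect : ∀ G i c D y e P → G + c * D + (i * c * D + i * c * e * (D * P) + y * (D * P) * (1 + e * P))
      ≡ G + (1 + i) * c * D + (i * c * e + y * (1 + e * P)) * (D * P)
    collect = solve-∀

  module _ {q A D P N n e c : ℕ} .{{_ : NonZero q}} .{{_ : NonZero D}} .{{_ : NonZero P}}
           (2q≤P : 2 * q ≤ P) (q^n≡1+eP : q ^ n ≡ 1 + e * P) (GeP≡cD : A * q ^ N * (e * P) ≡ c * D)
           (c⊥P : Coprime c P) where

    private
      instance
        D*P≢0 : NonZero (D * P)
        D*P≢0 = m*n≢0 D P

    orbit-reaches : ∀ m → ∃ λ J → ∃ λ K → A * q ^ J ≡ A * q ^ N % D + m * D + K * (D * P)
    orbit-reaches m
      with every-residue m (coprime⇒invertible (≤-trans (m≤m*n 2 q) 2q≤P) c⊥P)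
                           (≤-trans (<⇒≤ (m%n<n (A * q ^ N / D) P)) (m≤n+m P m))
    ... | i , z , m₀+ic≡m+zP with orbit {q} {A} {D} {P} {N} {n} {e} {c} q^n≡1+eP GeP≡cD i
    ... | y′ , orbit-i = N + n * i , z + (G / D / P + y′) , (begin
      A * q ^ (N + n * i)                              ≡⟨ orbit-i ⟩
      G + i * c * D + y′ * (D * P)                     ≡⟨ cong (λ x → x + i * c * D + y′ * (D * P)) G≡ρ+[m₀+z₀P]D ⟩
      ρ + (m₀ + z₀ * P) * D + i * c * D + y′ * (D * P) ≡⟨ regroup ρ m₀ z₀ P D i c y′ ⟩
      ρ + (m₀ + i * c) * D + (z₀ + y′) * (D * P)       ≡⟨ cong (λ x → ρ + x * D + (z₀ + y′) * (D * P)) m₀+ic≡m+zP ⟩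
      ρ + (m + z * P) * D + (z₀ + y′) * (D * P)        ≡⟨ regroup′ ρ m z P D (z₀ + y′) ⟩
      ρ + m * D + (z + (z₀ + y′)) * (D * P)            ∎)
      where
      open ≡-Reasoning
      G = A * q ^ N
      ρ = G % D
      m₀ = G / D % P
      z₀ = G / D / P
      G≡ρ+[m₀+z₀P]D : G ≡ ρ + (m₀ + z₀ * P) * D
      G≡ρ+[m₀+z₀P]D = trans (m≡m%n+[m/n]*n G D) (cong (λ x → ρ + x * D) (m≡m%n+[m/n]*n (G / D) P))
      regroup : ∀ ρ m₀ z₀ P D i c y →
        ρ + (m₀ + z₀ * P) * D + i * c * D + y * (D * P) ≡ ρ + (m₀ + i * c) * D + (z₀ + y) * (D * P)
      regroup = solve-∀
      regroup′ : ∀ ρ m z P D w → ρ + (m + z * P) * D + w * (D * P) ≡ ρ + m * D + (z + w) * (D * P)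
      regroup′ = solve-∀

    orbit-has-every-digit : (∀ j → ¬ D * P ∣ A * q ^ j) → ∀ d → d < q → HasFractionalDigit q A (D * P) d
    orbit-has-every-digit B∤ d d<q with digit-window {ρ = A * q ^ N % D} 2q≤P (m%n<n (A * q ^ N) D) d<q
    ... | m , lower , upper with orbit-reaches m
    ... | J , K , eq = suc J , s≤s z≤n , B∤ J , (begin
      A * q ^ suc J / (D * P) % q                             ≡⟨ cong (λ x → x / (D * P) % q) (x∙yz≈y∙xz A q (q ^ J)) ⟩
      q * (A * q ^ J) / (D * P) % q                           ≡⟨ cong (λ x → q * x / (D * P) % q) eq ⟩
      q * (A * q ^ N % D + m * D + K * (D * P)) / (D * P) % q ≡⟨ digit-of-remainder K d<q lower upper ⟩
      d                                                       ∎)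
      where open ≡-Reasoning

  hasFractionalDigit-cong : ∀ {q A B B′ d} .{{_ : NonZero q}} .{{_ : NonZero B}} .{{_ : NonZero B′}} →
    B ≡ B′ → HasFractionalDigit q A B d → HasFractionalDigit q A B′ d
  hasFractionalDigit-cong refl digit = digit

  /-cross : ∀ {n d A B} c .{{_ : NonZero d}} .{{_ : NonZero B}} → n * B ≡ A * d → n * c / d ≡ A * c / B
  /-cross {n} {d} {A} {B} c nB≡Ad = begin
    n * c / d                 ≡⟨ m*n/m*o≡n/o B (n * c) d ⟨
    B * (n * c) / (B * d)     ≡⟨ /-congˡ {o = B * d} (cross-multiply B n c A d nB≡Ad) ⟩
    d * (A * c) / (B * d)     ≡⟨ /-congʳ (*-comm B d) ⟩
    d * (A * c) / (d * B)     ≡⟨ m*n/m*o≡n/o d (A * c) B ⟩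
    A * c / B                 ∎
    where
    open ≡-Reasoning
    instance
      B*d≢0 = m*n≢0 B d
      d*B≢0 = m*n≢0 d B

  ∣-cross : ∀ {n d A B} c .{{_ : NonZero d}} → n * B ≡ A * d → d ∣ n * c → B ∣ A * c
  ∣-cross {n} {d} {A} {B} c nB≡Ad d∣nc =
    *-cancelˡ-∣ d (subst₂ _∣_ (*-comm B d) (cross-multiply B n c A d nB≡Ad) (*-monoʳ-∣ B d∣nc))

  module _ {p q s t a b ua w v : ℕ} (prime-p : Prime p) (1<q : 1 < q) (p∤q : ¬ p ∣ q) (p∤s : ¬ p ∣ s)
           (p∣t : p ∣ t) (a∥ : p ^ ua ∥ a) (b∥ : p ^ w ∥ b) (t∥ : p ^ v ∥ t) where

    private
      instance
        q≢0 : NonZero q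
        q≢0 = >-nonZero (<-trans z<s 1<q)

      g = 2 * q
      P = p ^ g
      0<g : 0 < g
      0<g = ≤-trans (s≤s z≤n) (m≤m*n 2 q)
      2q≤P : 2 * q ≤ P
      2q≤P = <⇒≤ (n<m^n g (nonTrivial⇒n>1 p {{prime⇒nonTrivial prime-p}}))
      Z = cofactor b∥ * cofactor t∥
      p∤Z : ¬ p ∣ Z
      p∤Z = ∤-* prime-p (p∤cofactor b∥) (p∤cofactor t∥)
      lifting = near-one-powers prime-p 1<q p∤q p∤Z {{∤⇒nonZero prime-p p∤Z}}
      e₀ = proj₁ lifting
      k₀ = e₀ + g + ua + g

    b*t^k≢0 : ∀ k → NonZero (b * t ^ k)
    b*t^k≢0 k = ∥⇒nonZero prime-p (∥-* prime-p b∥ (∥-^ prime-p t∥ k))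

    -- With L = v_p(b tᵏ) and g = 2 q, write b tᵏ = D p^g with D = p^(L − g) · (p-free part), and make
    -- v_p(qⁿ − 1) = L − g − v_p(a), so that a sᵏ q^N (qⁿ − 1) = c D with p ∤ c.
    private
      module AtExponent (k : ℕ) (k₀≤L : k₀ ≤ w + k * v) where
        L = w + k * v
        E = L ∸ g ∸ ua

        B∥ : p ^ L ∥ b * t ^ k
        B∥ = ∥-* prime-p b∥ (∥-^ prime-p t∥ k)
        A∥ : p ^ ua ∥ a * s ^ k
        A∥ = ∥-*-∤ prime-p a∥ (∤-^ prime-p k p∤s)

        e₀+g+ua≤L∸g : e₀ + g + ua ≤ L ∸ g
        e₀+g+ua≤L∸g = m+n≤o⇒m≤o∸n (e₀ + g + ua) k₀≤L
        e₀+g≤E : e₀ + g ≤ E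
        e₀+g≤E = m+n≤o⇒m≤o∸n (e₀ + g) e₀+g+ua≤L∸g
        ua≤L∸g : ua ≤ L ∸ g
        ua≤L∸g = ≤-trans (m≤n+m ua (e₀ + g)) e₀+g+ua≤L∸g

        open NearOne (proj₂ lifting k (≤-trans (m≤m+n e₀ g) e₀+g≤E))

        w₂ = cofactor W∥
        Bt = cofactor B∥

        Bt∣q^N*w₂ : Bt ∣ q ^ N * w₂
        Bt∣q^N*w₂ = ∣-trans Bt∣Z^k+1 Z^k+1∣q^N*w
          where
          Bt∣Z^k+1 : Bt ∣ Z ^ suc k
          Bt∣Z^k+1 = subst (Bt ∣_) (sym (^-distribʳ-* (cofactor b∥) (cofactor t∥) (suc k)))
            (*-pres-∣ (m∣m*n {cofactor b∥} (cofactor b∥ ^ k)) (n∣m*n (cofactor t∥) {cofactor t∥ ^ k}))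

        h = quotient Bt∣q^N*w₂
        c = cofactor A∥ * h
        D = p ^ (L ∸ g) * Bt

        instance
          P≢0 : NonZero P
          P≢0 = m^n≢0 p g {{prime⇒nonZero prime-p}}
          D≢0 : NonZero D
          D≢0 = m*n≢0 (p ^ (L ∸ g)) Bt {{m^n≢0 p (L ∸ g) {{prime⇒nonZero prime-p}}}}
                                        {{∤⇒nonZero prime-p (p∤cofactor B∥)}}

        p∤c : ¬ p ∣ c
        p∤c = ∤-* prime-p (p∤cofactor A∥) p∤h
          where
          p∤h : ¬ p ∣ h
          p∤h p∣h = ∤-* prime-p (∤-^ prime-p N p∤q) (p∤cofactor W∥)
            (subst (p ∣_) (sym (m∣n⇒n≡quotient*m Bt∣q^N*w₂)) (∣m⇒∣m*n Bt p∣h))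

        b*t^k≡D*P : b * t ^ k ≡ D * P
        b*t^k≡D*P = trans (m≡p^e*cofactor B∥) (^-split p L g Bt (≤-trans (m≤n+m g (e₀ + g + ua)) k₀≤L))

        W≡eP : W ≡ p ^ (E ∸ g) * w₂ * P
        W≡eP = trans (m≡p^e*cofactor W∥) (^-split p E g w₂ (≤-trans (m≤n+m g e₀) e₀+g≤E))

        GeP≡cD : a * s ^ k * q ^ N * (p ^ (E ∸ g) * w₂ * P) ≡ c * D
        GeP≡cD = begin
          a * s ^ k * q ^ N * (p ^ (E ∸ g) * w₂ * P)
            ≡⟨ cong₂ (λ x y → x * q ^ N * y) (m≡p^e*cofactor A∥) (sym W≡eP) ⟩
          p ^ ua * cofactor A∥ * q ^ N * W
            ≡⟨ cong (p ^ ua * cofactor A∥ * q ^ N *_) (m≡p^e*cofactor W∥) ⟩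
          p ^ ua * cofactor A∥ * q ^ N * (p ^ E * w₂)
            ≡⟨ regroup (p ^ ua) (cofactor A∥) (q ^ N) (p ^ E) w₂ ⟩
          p ^ ua * p ^ E * cofactor A∥ * (q ^ N * w₂)
            ≡⟨ cong₂ (λ x y → x * cofactor A∥ * y) p^ua*p^E≡p^[L∸g] (m∣n⇒n≡quotient*m Bt∣q^N*w₂) ⟩
          p ^ (L ∸ g) * cofactor A∥ * (h * Bt)
            ≡⟨ regroup′ (p ^ (L ∸ g)) (cofactor A∥) h Bt ⟩
          c * D
            ∎
          where
          open ≡-Reasoning
          p^ua*p^E≡p^[L∸g] : p ^ ua * p ^ E ≡ p ^ (L ∸ g)
          p^ua*p^E≡p^[L∸g] = trans (sym (^-distribˡ-+-* p ua E)) (cong (p ^_) (m+[n∸m]≡n ua≤L∸g))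
          regroup : ∀ x a q y w → x * a * q * (y * w) ≡ x * y * a * (q * w)
          regroup = solve-∀
          regroup′ : ∀ x a h B → x * a * (h * B) ≡ a * h * (x * B)
          regroup′ = solve-∀

        non-terminating : ∀ j → ¬ D * P ∣ a * s ^ k * q ^ j
        non-terminating j = subst (λ B → ¬ B ∣ a * s ^ k * q ^ j) b*t^k≡D*P
          (∥∧∥⇒∤ prime-p (∥-*-∤ prime-p A∥ (∤-^ prime-p j p∤q)) B∥ ua<L)
          where
          ua<L : ua < L
          ua<L = <-≤-trans (m<n+m ua (<-≤-trans 0<g (m≤n+m g e₀))) (≤-trans e₀+g+ua≤L∸g (m∸n≤m L g))

        every-digit : ∀ d → d < q → HasFractionalDigit q (a * s ^ k) (b * t ^ k) d {{q≢0}} {{b*t^k≢0 k}}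
        every-digit d d<q =
          hasFractionalDigit-cong {A = a * s ^ k} {{q≢0}} {{m*n≢0 D P}} {{b*t^k≢0 k}} (sym b*t^k≡D*P)
            (orbit-has-every-digit {A = a * s ^ k} {N = N} {n = n} {e = p ^ (E ∸ g) * w₂}
              2q≤P (trans q^n≡1+W (cong suc W≡eP)) GeP≡cD (Coprime.sym (∤⇒coprime-^ prime-p g p∤c))
              non-terminating d d<q)

    powers-have-every-digit : ∃ λ k₀ → ∀ k → k₀ ≤ k → ∀ d → d < q →
      HasFractionalDigit q (a * s ^ k) (b * t ^ k) d {{q≢0}} {{b*t^k≢0 k}}
    powers-have-every-digit = k₀ , λ k k₀≤k → AtExponent.every-digit k (≤-trans k₀≤k (k≤L k))
      where
      k≤L : ∀ k → k ≤ w + k * v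
      k≤L k = ≤-trans (m≤m*n k v {{>-nonZero 1≤v}}) (m≤n+m (k * v) w)
        where
        1≤v : 1 ≤ v
        1≤v = ∥∧^∣⇒≤ prime-p t∥ (subst (_∣ t) (sym (*-identityʳ p)) p∣t)

module Fractions where
  open import Data.Nat
  open import Data.Nat.Properties
  open import Data.Nat.Coprimality using (Coprime)
  open import Data.Nat.Tactic.RingSolver using (solve-∀)
  open import Data.Integer as ℤ using (+_; +[1+_]; ∣_∣)
  import Data.Integer.Properties as ℤ
  open import Data.Rational as ℚ using (ℚ; mkℚ; ↥_; ↧_; ↧ₙ_; Positive)
  import Data.Rational.Properties as ℚ
  open import Data.Product using (_,_)
  open import Data.Sum using (inj₂)
  open import Relation.Binary.PropositionalEquality
  open Expansion using (HasFractionalDigit; /-cross; ∣-cross)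

  -- x = A / B, not necessarily in lowest terms.
  record Represents (x : ℚ) (A B : ℕ) : Set where
    constructor represents
    field cross : ∣ ↥ x ∣ * B ≡ A * ↧ₙ x

  represents-self : ∀ x → Represents x ∣ ↥ x ∣ (↧ₙ x)
  represents-self x = represents refl

  represents-* : ∀ x y {A₁ B₁ A₂ B₂} → Represents x A₁ B₁ → Represents y A₂ B₂ →
    Represents (x ℚ.* y) (A₁ * A₂) (B₁ * B₂)
  represents-* x y {A₁} {B₁} {A₂} {B₂} (represents x≈) (represents y≈) =
    represents (cancel-gcd _ (ℚ.↥-* x y) (ℚ.↧-* x y))
    where
    open ≡-Reasoning
    N = ∣ ↥ (x ℚ.* y) ∣
    D = ↧ₙ (x ℚ.* y)
    regroup : ∀ N B₁ B₂ D g → N * (B₁ * B₂) * (D * g) ≡ N * g * B₁ * B₂ * D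
    regroup = solve-∀
    regroup′ : ∀ nx ny B₁ B₂ D → nx * ny * B₁ * B₂ * D ≡ nx * B₁ * (ny * B₂) * D
    regroup′ = solve-∀
    regroup″ : ∀ A₁ dx A₂ dy D → A₁ * dx * (A₂ * dy) * D ≡ A₁ * A₂ * D * (dx * dy)
    regroup″ = solve-∀
    -- Multiplying by ↧ₙ x · ↧ₙ y = D · ∣ G ∣ avoids dividing by the normalising gcd G.
    cancel-gcd : ∀ G → ↥ (x ℚ.* y) ℤ.* G ≡ ↥ x ℤ.* ↥ y → ↧ (x ℚ.* y) ℤ.* G ≡ ↧ x ℤ.* ↧ y →
      ∣ ↥ (x ℚ.* y) ∣ * (B₁ * B₂) ≡ A₁ * A₂ * ↧ₙ (x ℚ.* y)
    cancel-gcd G ↥≡ ↧≡ = *-cancelʳ-≡ _ _ (↧ₙ x * ↧ₙ y) {{m*n≢0 (↧ₙ x) (↧ₙ y)}} (begin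
      N * (B₁ * B₂) * (↧ₙ x * ↧ₙ y)            ≡⟨ cong (N * (B₁ * B₂) *_) D*g≡dxdy ⟨
      N * (B₁ * B₂) * (D * ∣ G ∣)              ≡⟨ regroup N B₁ B₂ D ∣ G ∣ ⟩
      N * ∣ G ∣ * B₁ * B₂ * D                  ≡⟨ cong (λ z → z * B₁ * B₂ * D) N*g≡nxny ⟩
      ∣ ↥ x ∣ * ∣ ↥ y ∣ * B₁ * B₂ * D          ≡⟨ regroup′ ∣ ↥ x ∣ ∣ ↥ y ∣ B₁ B₂ D ⟩
      ∣ ↥ x ∣ * B₁ * (∣ ↥ y ∣ * B₂) * D        ≡⟨ cong₂ (λ u w → u * w * D) x≈ y≈ ⟩
      A₁ * ↧ₙ x * (A₂ * ↧ₙ y) * D              ≡⟨ regroup″ A₁ (↧ₙ x) A₂ (↧ₙ y) D ⟩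
      A₁ * A₂ * D * (↧ₙ x * ↧ₙ y)              ∎)
      where
      N*g≡nxny : N * ∣ G ∣ ≡ ∣ ↥ x ∣ * ∣ ↥ y ∣
      N*g≡nxny = trans (sym (ℤ.abs-* (↥ (x ℚ.* y)) G)) (trans (cong ∣_∣ ↥≡) (ℤ.abs-* (↥ x) (↥ y)))
      D*g≡dxdy : D * ∣ G ∣ ≡ ↧ₙ x * ↧ₙ y
      D*g≡dxdy = trans (sym (ℤ.abs-* (↧ (x ℚ.* y)) G)) (trans (cong ∣_∣ ↧≡) (ℤ.abs-* (↧ x) (↧ y)))

  represents-/ : ∀ s t .{{_ : NonZero t}} → Coprime s t → Represents ((+ s) ℚ./ t) s t
  represents-/ s (suc t) s⊥t rewrite ℚ.normalize-coprime {s} {t} s⊥t = represents refl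

  represents-^ : ∀ {x A B} → Represents x A B → ∀ k → Represents (x ^ℚ k) (A ^ k) (B ^ k)
  represents-^ x≈ zero    = represents refl
  represents-^ {x} x≈ (suc k) = represents-* x (x ^ℚ k) x≈ (represents-^ x≈ k)

  hasDigit-fromFraction : ∀ {q x A B d} .{{_ : NonZero q}} .{{_ : NonZero B}} → Represents x A B →
    HasFractionalDigit q A B d → HasDigit q x d
  hasDigit-fromFraction {q} {x} {A} (represents x≈) (j , 1≤j , B∤ , digit) =
    inj₂ (j , 1≤j , (λ d∣ → B∤ (∣-cross {∣ ↥ x ∣} {A = A} (q ^ (j ∸ 1)) x≈ d∣)) ,
          trans (cong (_% q) (/-cross {∣ ↥ x ∣} {A = A} (q ^ j) x≈)) digit)

  positive⇒∣↥∣≢0 : ∀ α → Positive α → NonZero ∣ ↥ α ∣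
  positive⇒∣↥∣≢0 (mkℚ +[1+ _ ] _ _) _ = _

open import Data.Nat as ℕ using (ℕ; _≤_; _<_; NonZero; s≤s; z≤n)
import Data.Nat.Properties as ℕ
open import Data.Nat.Divisibility using (_∣_)
open import Data.Nat.Coprimality using (Coprime)
open import Data.Nat.Primality using (Prime)
open import Data.Integer using (+_; ∣_∣)
open import Data.Rational using (ℚ; ↥_; ↧ₙ_; Positive; _/_; _*_)
open import Data.Product using (Σ; _×_; _,_; proj₂)
open import Relation.Nullary using (¬_)
open PrimePowers using (valuation; coprime∧∣⇒∤)
open Expansion using (powers-have-every-digit)
open Fractions

corollary1p6 : (q : ℕ) → .{{_ : NonZero q}} → 3 ≤ q →
    (s t : ℕ) → .{{_ : NonZero t}} → 0 < s → s < t → Coprime s t →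
    (Σ ℕ λ p → Prime p × p ∣ t × ¬ (p ∣ q)) →
    (α : ℚ) → Positive α →
    Σ ℕ λ kα → (k : ℕ) → kα ≤ k → (d : ℕ) → d < q →
      HasDigit q (α * (((+ s) / t) ^ℚ k)) d
corollary1p6 q 3≤q s t _ _ s⊥t (p , prime-p , p∣t , p∤q) α α>0 =
  let k₀ , digits = powers-have-every-digit prime-p (ℕ.≤-trans (s≤s (s≤s z≤n)) 3≤q) p∤q
                      (coprime∧∣⇒∤ prime-p s⊥t p∣t) p∣t
                      (proj₂ (valuation prime-p ∣ ↥ α ∣ {{positive⇒∣↥∣≢0 α α>0}}))
                      (proj₂ (valuation prime-p (↧ₙ α))) (proj₂ (valuation prime-p t))
  in k₀ , λ k k₀≤k d d<q →
    hasDigit-fromFraction {{_}} {{ℕ.m*n≢0 (↧ₙ α) (t ℕ.^ k) {{_}} {{ℕ.m^n≢0 t k}}}}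
      (represents-* α _ (represents-self α) (represents-^ (represents-/ s t s⊥t) k)) (digits k k₀≤k d d<q)
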